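{- Let $G=(X,E)$ be a graph on $n$ vertices (Boolean variables), let $\{e_1,\dots,e_m\}$ be an induced matching of $G$, and let $(X_1,X_2)$ be a partition of $X$ such that each $e_i$ has one endpoint in $X_1$ and one in $X_2$. Then every monochromatic rectangle for $\mathsf{IP}_G$ with partition $(X_1,X_2)$ has size at most $2^{n-m}$.
   Context: $\mathsf{IP}_G(X) := \bigoplus_{xy\in E} x\cdot y$ (parity of the number of edges both of whose endpoints are set to $1$). For a partition $(X_1,X_2)$ of $X$, a rectangle is a function $R_1(X_1)\land R_2(X_2)$, i.e. a set $A\times B$ of assignments; its size is its number of models. It is monochromatic for $\mathsf{IP}_G$ if $\mathsf{IP}_G$ is constant on its models. An induced matching is a set of pairwise vertex-disjoint edges such that no other edge of $G$ joins two endpoints of these edges. -}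

module Defs where

open import Data.Nat using (ℕ; zero; suc; _<_)
open import Data.Bool using (Bool; true; false; _∧_; _xor_; if_then_else_)
open import Data.Fin using (Fin; toℕ)
open import Data.Vec using (Vec; []; _∷_; lookup)
open import Data.List using (List; []; _∷_; map; concatMap; _++_; length; filter; foldr; allFin)
open import Data.Product using (_×_; _,_; proj₁; proj₂; ∃)
open import Relation.Binary.PropositionalEquality using (_≡_; _≢_)
open import Relation.Nullary using (¬_)
open import Data.Bool.Properties using (T?)

record Graph (n : ℕ) : Set where
  field
    adj      : Fin n → Fin n → Bool
    symmetric  : ∀ i j → adj i j ≡ adj j i
    irreflexive : ∀ i → adj i i ≡ false
open Graph public

Assignment : ℕ → Set
Assignment n = Vec Bool n

allAssignments : (n : ℕ) → List (Assignment n)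
allAssignments zero = [] ∷ []
allAssignments (suc n) =
  map (false ∷_) (allAssignments n) ++ map (true ∷_) (allAssignments n)

-- All unordered pairs {i,j} with toℕ i < toℕ j, each exactly once.
orderedPairs : (n : ℕ) → List (Fin n × Fin n)
orderedPairs n = concatMap (λ i → map (i ,_) (filter (λ j → Data.Nat._<?_ (toℕ i) (toℕ j)) (allFin n))) (allFin n)
  where import Data.Nat

IP : {n : ℕ} → Graph n → Assignment n → Bool
IP {n} G x = foldr (λ p acc → (adj G (proj₁ p) (proj₂ p) ∧ (lookup x (proj₁ p) ∧ lookup x (proj₂ p))) xor acc)
                   false (orderedPairs n)

-- A partition (X₁,X₂) of the variables: side i ≡ false means i ∈ X₁, true means i ∈ X₂.
Partition : ℕ → Set
Partition n = Fin n → Bool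

DependsOnlyOn : {n : ℕ} → Partition n → Bool → (Assignment n → Bool) → Set
DependsOnlyOn {n} P s f =
  ∀ (x y : Assignment n) → (∀ i → P i ≡ s → lookup x i ≡ lookup y i) → f x ≡ f y

record Rectangle {n : ℕ} (P : Partition n) : Set where
  field
    R₁ : Assignment n → Bool
    R₂ : Assignment n → Bool
    R₁-X₁ : DependsOnlyOn P false R₁
    R₂-X₂ : DependsOnlyOn P true R₂
open Rectangle public

rect : {n : ℕ} {P : Partition n} → Rectangle P → Assignment n → Bool
rect R x = R₁ R x ∧ R₂ R x

size : {n : ℕ} {P : Partition n} → Rectangle P → ℕ
size {n} R = length (filter (λ x → T? (rect R x)) (allAssignments n))

Monochromatic : {n : ℕ} {P : Partition n} → Graph n → Rectangle P → Set
Monochromatic {n} G R = ∃ λ (b : Bool) → ∀ (x : Assignment n) → rect R x ≡ true → IP G x ≡ b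

record InducedMatching {n : ℕ} (G : Graph n) (m : ℕ) : Set where
  field
    u v : Fin m → Fin n
    isEdge : ∀ i → adj G (u i) (v i) ≡ true
    disj-uu : ∀ i j → i ≢ j → u i ≢ u j
    disj-vv : ∀ i j → i ≢ j → v i ≢ v j
    disj-uv : ∀ i j → i ≢ j → u i ≢ v j
    ind-uu : ∀ i j → i ≢ j → adj G (u i) (u j) ≡ false
    ind-vv : ∀ i j → i ≢ j → adj G (v i) (v j) ≡ false
    ind-uv : ∀ i j → i ≢ j → adj G (u i) (v j) ≡ false
open InducedMatching public

module Submission where

-- Fix an assignment z and overwrite the X₁-endpoints of the matching by s and the X₂-endpoints by t;
-- on this slice the rectangle becomes A_z × B_z. On the four corners (s,t), (s',t), (s,t'), (s',t') of a
-- combinatorial rectangle the xor of the values of IP_G is ⊕ d_i d_j over the edges ij crossing the cut, d being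
-- the difference of opposite corners, and since the matching is induced this equals ⟨s ⊕ s', t ⊕ t'⟩.
-- Monochromaticity thus makes every difference of A_z orthogonal to every difference of B_z, and Lindsey's
-- lemma gives |A_z| |B_z| ≤ 2^m. Summing over all 2^n choices of z counts each model of R exactly 4^m times,
-- so 4^m |R| ≤ 2^n 2^m.

open import Defs
open import Data.Nat using (ℕ; _≤_; _^_; _∸_)
open import Relation.Binary.PropositionalEquality using (_≢_)

open import Algebra.Bundles using (CommutativeRing)
open import Data.Bool using (Bool; true; false; _∧_; _∨_; _xor_; not; if_then_else_)
open import Data.Bool.Properties
  using (T?; ¬-not; xor-same; xor-assoc; xor-identityʳ; ∧-comm; ∧-zeroʳ; ∧-distribˡ-xor; ∧-distribʳ-xor;
         xor-∧-commutativeRing)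
open import Data.Empty using (⊥; ⊥-elim)
open import Data.Fin using (Fin; zero; suc; toℕ)
open import Data.Fin.Properties using (suc-injective; any?; injective⇒≤) renaming (_≟_ to _≟ᶠ_; <-cmp to <-cmpᶠ)
open import Data.List using (List; []; _∷_; map; filter; length; _++_; foldr; concatMap; tabulate; allFin)
open import Data.List.Properties using (length-++; filter-++; foldr-map)
open import Data.Nat using (zero; suc; _+_; _*_; _≟_; _<?_; z≤n)
open import Data.Nat.Properties
  using (≤-refl; ≤-trans; ≤-reflexive; module ≤-Reasoning; m≤m+n; +-mono-≤; +-identityʳ; *-identityˡ; *-zeroʳ;
         *-comm; *-assoc; *-distribˡ-+; *-distribʳ-+; *-cancelˡ-≤; ^-distribˡ-+-*; m^n≢0; m+[n∸m]≡n;
         +-commutativeSemigroup)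
open import Data.Product using (_×_; _,_; ∃; proj₁; proj₂)
open import Data.Sum using (_⊎_; inj₁; inj₂)
open import Data.Vec using ([]; _∷_; lookup; zipWith; _[_]≔_)
open import Data.Vec.Properties using (lookup∘update; lookup∘update′; lookup-zipWith)
open import Function using (_∘_; id)
open import Function.Definitions using (Injective)
open import Relation.Binary.Definitions using (tri<; tri≈; tri>)
open import Relation.Binary.PropositionalEquality using (_≡_; refl; sym; trans; cong; cong₂; subst; module ≡-Reasoning)
open import Relation.Nullary using (yes; no; does)
open import Relation.Nullary.Decidable using (dec-true; dec-false)
open import Relation.Unary using (Decidable)

open import Algebra.Properties.CommutativeSemigroup +-commutativeSemigroup using (interchange)
open import Algebra.Properties.Semiring.Sum (CommutativeRing.semiring xor-∧-commutativeRing)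
  using (sum; sum-syntax; sum-cong-≗; sum-replicate-zero; ∑-comm; ∑-distrib-+)

-- Counting assignments

indicator : Bool → ℕ
indicator false = 0
indicator true  = 1

sumOver : (n : ℕ) → (Assignment n → ℕ) → ℕ
sumOver zero    f = f []
sumOver (suc n) f = sumOver n (f ∘ (false ∷_)) + sumOver n (f ∘ (true ∷_))

count : {n : ℕ} → (Assignment n → Bool) → ℕ
count {n} A = sumOver n (indicator ∘ A)

sumOver-cong : ∀ n {f g : Assignment n → ℕ} → (∀ x → f x ≡ g x) → sumOver n f ≡ sumOver n g
sumOver-cong zero    f≗g = f≗g []
sumOver-cong (suc n) f≗g = cong₂ _+_ (sumOver-cong n (f≗g ∘ (false ∷_))) (sumOver-cong n (f≗g ∘ (true ∷_)))

sumOver-+ : ∀ n (f g : Assignment n → ℕ) → sumOver n (λ x → f x + g x) ≡ sumOver n f + sumOver n g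
sumOver-+ zero    f g = refl
sumOver-+ (suc n) f g =
  trans (cong₂ _+_ (sumOver-+ n (f ∘ (false ∷_)) (g ∘ (false ∷_))) (sumOver-+ n (f ∘ (true ∷_)) (g ∘ (true ∷_))))
        (interchange (sumOver n (f ∘ (false ∷_))) (sumOver n (g ∘ (false ∷_)))
                     (sumOver n (f ∘ (true ∷_))) (sumOver n (g ∘ (true ∷_))))

sumOver-*ˡ : ∀ n c (f : Assignment n → ℕ) → sumOver n (λ x → c * f x) ≡ c * sumOver n f
sumOver-*ˡ zero    c f = refl
sumOver-*ˡ (suc n) c f =
  trans (cong₂ _+_ (sumOver-*ˡ n c _) (sumOver-*ˡ n c _)) (sym (*-distribˡ-+ c _ _))

sumOver-bounded : ∀ n {f : Assignment n → ℕ} c → (∀ x → f x ≤ c) → sumOver n f ≤ 2 ^ n * c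
sumOver-bounded zero    c f≤c = ≤-trans (f≤c []) (≤-reflexive (sym (*-identityˡ c)))
sumOver-bounded (suc n) {f} c f≤c = begin
  sumOver (suc n) f              ≤⟨ +-mono-≤ (sumOver-bounded n c (f≤c ∘ (false ∷_)))
                                             (sumOver-bounded n c (f≤c ∘ (true ∷_))) ⟩
  2 ^ n * c + 2 ^ n * c          ≡⟨ cong (2 ^ n * c +_) (sym (+-identityʳ _)) ⟩
  2 * (2 ^ n * c)                ≡⟨ sym (*-assoc 2 (2 ^ n) c) ⟩
  2 ^ suc n * c                  ∎
  where open ≤-Reasoning

sumOver-product : ∀ l l' (f : Assignment l → ℕ) (g : Assignment l' → ℕ) →
  sumOver l f * sumOver l' g ≡ sumOver l (λ s → sumOver l' (λ t → f s * g t))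
sumOver-product l l' f g = begin
  sumOver l f * sumOver l' g                        ≡⟨ *-comm (sumOver l f) _ ⟩
  sumOver l' g * sumOver l f                        ≡⟨ sym (sumOver-*ˡ l (sumOver l' g) f) ⟩
  sumOver l (λ s → sumOver l' g * f s)              ≡⟨ sumOver-cong l (λ s → *-comm (sumOver l' g) (f s)) ⟩
  sumOver l (λ s → f s * sumOver l' g)              ≡⟨ sumOver-cong l (λ s → sym (sumOver-*ˡ l' (f s) g)) ⟩
  sumOver l (λ s → sumOver l' (λ t → f s * g t))    ∎
  where open ≡-Reasoning

indicator-∧ : ∀ a b → indicator (a ∧ b) ≡ indicator a * indicator b
indicator-∧ false b = refl
indicator-∧ true  b = sym (+-identityʳ (indicator b))

count-∨-disjoint : ∀ {n} (A A' : Assignment n → Bool) → (∀ x → A x ≡ true → A' x ≡ true → ⊥) →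
  count (λ x → A x ∨ A' x) ≡ count A + count A'
count-∨-disjoint {n} A A' disjoint =
  trans (sumOver-cong n (λ x → indicator-∨ (A x) (A' x) (disjoint x))) (sumOver-+ n _ _)
  where
  indicator-∨ : ∀ a a' → (a ≡ true → a' ≡ true → ⊥) → indicator (a ∨ a') ≡ indicator a + indicator a'
  indicator-∨ true  true  both = ⊥-elim (both refl refl)
  indicator-∨ true  false _    = refl
  indicator-∨ false a'    _    = refl

count-nonzero : ∀ n (A : Assignment n → Bool) → count A ≢ 0 → ∃ λ x → A x ≡ true
count-nonzero zero A count≢0 with A [] in A[]
... | true  = [] , A[]
... | false = ⊥-elim (count≢0 refl)
count-nonzero (suc n) A count≢0 with count (A ∘ (false ∷_)) ≟ 0
... | no  c₀≢0 = let x , Ax = count-nonzero n _ c₀≢0 in false ∷ x , Ax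
... | yes c₀≡0 = let x , Ax = count-nonzero n _ (count≢0 ∘ cong₂ _+_ c₀≡0) in true ∷ x , Ax

length-filter-∷ : ∀ {X : Set} (A : X → Bool) x xs →
  length (filter (λ y → T? (A y)) (x ∷ xs)) ≡ indicator (A x) + length (filter (λ y → T? (A y)) xs)
length-filter-∷ A x xs with A x
... | true  = refl
... | false = refl

length-filter-map : ∀ {X Y : Set} (A : Y → Bool) (g : X → Y) xs →
  length (filter (λ y → T? (A y)) (map g xs)) ≡ length (filter (λ x → T? (A (g x))) xs)
length-filter-map A g []       = refl
length-filter-map A g (x ∷ xs) = begin
  length (filter (λ y → T? (A y)) (g x ∷ map g xs))       ≡⟨ length-filter-∷ A (g x) (map g xs) ⟩
  indicator (A (g x)) + length (filter _ (map g xs))      ≡⟨ cong (indicator (A (g x)) +_) (length-filter-map A g xs) ⟩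
  indicator (A (g x)) + length (filter _ xs)              ≡⟨ length-filter-∷ (A ∘ g) x xs ⟨
  length (filter (λ x → T? (A (g x))) (x ∷ xs))           ∎
  where open ≡-Reasoning

length-filter-allAssignments : ∀ n (A : Assignment n → Bool) →
  length (filter (λ x → T? (A x)) (allAssignments n)) ≡ count A
length-filter-allAssignments zero    A = trans (length-filter-∷ A [] []) (+-identityʳ _)
length-filter-allAssignments (suc n) A = begin
  length (filter A? (map (false ∷_) all ++ map (true ∷_) all))
    ≡⟨ cong length (filter-++ A? (map (false ∷_) all) _) ⟩
  length (filter A? (map (false ∷_) all) ++ filter A? (map (true ∷_) all))
    ≡⟨ length-++ (filter A? (map (false ∷_) all)) ⟩
  length (filter A? (map (false ∷_) all)) + length (filter A? (map (true ∷_) all))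
    ≡⟨ cong₂ _+_ (trans (length-filter-map A (false ∷_) all) (length-filter-allAssignments n _))
                 (trans (length-filter-map A (true ∷_) all) (length-filter-allAssignments n _)) ⟩
  count A ∎
  where
  open ≡-Reasoning
  all = allAssignments n
  A? = λ x → T? (A x)

-- Lindsey's lemma

ip : ∀ {l} → Assignment l → Assignment l → Bool
ip {l} x y = ∑[ k < l ] (lookup x k ∧ lookup y k)

ip-self : ∀ {l} (s t : Assignment l) → ip (zipWith _xor_ s s) t ≡ false
ip-self []      []      = refl
ip-self (a ∷ s) (b ∷ t) rewrite xor-same a = ip-self s t

OrthogonalDifferences : ∀ {l} → (A B : Assignment l → Bool) → Set
OrthogonalDifferences A B = ∀ s s' t t' → A s ≡ true → A s' ≡ true → B t ≡ true → B t' ≡ true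
  → ip (zipWith _xor_ s s') (zipWith _xor_ t t') ≡ false

restrict : ∀ {l} → Bool → (Assignment (suc l) → Bool) → Assignment l → Bool
restrict a A s = A (a ∷ s)

orthogonal-restrict : ∀ {l} {A B : Assignment (suc l) → Bool} {A' : Assignment l → Bool} →
  OrthogonalDifferences A B → (∀ {s} → A' s ≡ true → ∃ λ a → A (a ∷ s) ≡ true) →
  ∀ b → OrthogonalDifferences A' (restrict b B)
orthogonal-restrict orth lift b s s' t t' A's A's' Bt Bt'
  with a , As ← lift A's | a' , As' ← lift A's' =
  trans (sym first-coordinate-vanishes) (orth (a ∷ s) (a' ∷ s') (b ∷ t) (b ∷ t') As As' Bt Bt')
  where
  first-coordinate-vanishes :
    ((a xor a') ∧ (b xor b)) xor ip (zipWith _xor_ s s') (zipWith _xor_ t t') ≡ ip (zipWith _xor_ s s') (zipWith _xor_ t t')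
  first-coordinate-vanishes rewrite xor-same b | ∧-zeroʳ (a xor a') = refl

≤2^⇒+≤2^suc : ∀ {x y} l → x ≤ 2 ^ l → y ≤ 2 ^ l → x + y ≤ 2 ^ suc l
≤2^⇒+≤2^suc l x≤ y≤ = +-mono-≤ x≤ (≤-trans y≤ (m≤m+n (2 ^ l) 0))

lindsey : ∀ l (A B : Assignment l → Bool) → OrthogonalDifferences A B → count A * count B ≤ 2 ^ l
lindsey zero    A B _    = indicator-*-≤1 (A []) (B [])
  where
  indicator-*-≤1 : ∀ a b → indicator a * indicator b ≤ 1
  indicator-*-≤1 true  true  = ≤-refl
  indicator-*-≤1 true  false = z≤n
  indicator-*-≤1 false _     = z≤n
-- If B₀ or B₁ is empty, the induction hypothesis on the halves suffices;
-- otherwise A₀ and A₁ are disjoint and A₀ ∪ A₁ still has orthogonal differences with each B_b.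
lindsey (suc l) A B orth = ≤-trans (≤-reflexive (*-distribˡ-+ (count A) (count B₀) (count B₁))) split
  where
  A₀ = restrict false A
  A₁ = restrict true A
  B₀ = restrict false B
  B₁ = restrict true B
  IH : ∀ a b → count (restrict a A) * count (restrict b B) ≤ 2 ^ l
  IH a b = lindsey l (restrict a A) (restrict b B) (orthogonal-restrict {A' = restrict a A} orth (a ,_) b)
  split : count A * count B₀ + count A * count B₁ ≤ 2 ^ suc l
  split with count B₀ ≟ 0 | count B₁ ≟ 0
  ... | yes B₀≡0 | _ = begin
    count A * count B₀ + count A * count B₁
      ≡⟨ cong₂ _+_ (trans (cong (count A *_) B₀≡0) (*-zeroʳ (count A)))
                   (*-distribʳ-+ (count B₁) (count A₀) (count A₁)) ⟩
    count A₀ * count B₁ + count A₁ * count B₁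
      ≤⟨ ≤2^⇒+≤2^suc l (IH false true) (IH true true) ⟩
    2 ^ suc l ∎
    where open ≤-Reasoning
  ... | no _ | yes B₁≡0 = begin
    count A * count B₀ + count A * count B₁
      ≡⟨ cong₂ _+_ (*-distribʳ-+ (count B₀) (count A₀) (count A₁))
                   (trans (cong (count A *_) B₁≡0) (*-zeroʳ (count A))) ⟩
    (count A₀ * count B₀ + count A₁ * count B₀) + 0
      ≡⟨ +-identityʳ _ ⟩
    count A₀ * count B₀ + count A₁ * count B₀
      ≤⟨ ≤2^⇒+≤2^suc l (IH false false) (IH true false) ⟩
    2 ^ suc l ∎
    where open ≤-Reasoning
  ... | no B₀≢0 | no B₁≢0 = ≤2^⇒+≤2^suc l (merged false) (merged true)
    where
    t₀ = count-nonzero l B₀ B₀≢0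
    t₁ = count-nonzero l B₁ B₁≢0
    -- The first coordinates contribute 1 ∧ 1 and the rest ⟨s ⊕ s, _⟩ = 0.
    disjoint : ∀ s → A₀ s ≡ true → A₁ s ≡ true → ⊥
    disjoint s A₀s A₁s
      with () ← trans (sym (cong not (ip-self s (zipWith _xor_ (proj₁ t₀) (proj₁ t₁)))))
                      (orth (false ∷ s) (true ∷ s) (false ∷ proj₁ t₀) (true ∷ proj₁ t₁)
                            A₀s A₁s (proj₂ t₀) (proj₂ t₁))
    lift : ∀ {s} → (A₀ s ∨ A₁ s) ≡ true → ∃ λ a → A (a ∷ s) ≡ true
    lift {s} A∪s with A₀ s in A₀s
    ... | true  = false , A₀s
    ... | false = true , A∪s
    merged : ∀ b → count A * count (restrict b B) ≤ 2 ^ l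
    merged b = subst (λ c → c * count (restrict b B) ≤ 2 ^ l) (count-∨-disjoint A₀ A₁ disjoint)
      (lindsey l (λ s → A₀ s ∨ A₁ s) (restrict b B) (orthogonal-restrict {A' = λ s → A₀ s ∨ A₁ s} orth lift b))

-- Overwriting coordinates

write : ∀ {l n} → (Fin l → Fin n) → Assignment l → Assignment n → Assignment n
write ps []      z = z
write ps (a ∷ s) z = write (ps ∘ suc) s z [ ps zero ]≔ a

lookup-write-∉ : ∀ {l n} (ps : Fin l → Fin n) s z {i} → (∀ k → ps k ≢ i) →
  lookup (write ps s z) i ≡ lookup z i
lookup-write-∉ ps []      z i∉ = refl
lookup-write-∉ ps (a ∷ s) z i∉ =
  trans (lookup∘update′ (i∉ zero ∘ sym) (write (ps ∘ suc) s z) a) (lookup-write-∉ (ps ∘ suc) s z (i∉ ∘ suc))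

lookup-write-∈ : ∀ {l n} {ps : Fin l → Fin n} → Injective _≡_ _≡_ ps → ∀ s z k →
  lookup (write ps s z) (ps k) ≡ lookup s k
lookup-write-∈ {ps = ps} inj (a ∷ s) z zero    = lookup∘update (ps zero) (write (ps ∘ suc) s z) a
lookup-write-∈ {ps = ps} inj (a ∷ s) z (suc k) =
  trans (lookup∘update′ ps₁≢ps₀ (write (ps ∘ suc) s z) a) (lookup-write-∈ (suc-injective ∘ inj) s z k)
  where
  ps₁≢ps₀ : ps (suc k) ≢ ps zero
  ps₁≢ps₀ e with () ← inj e

Agree : ∀ {n} → Partition n → Bool → Assignment n → Assignment n → Set
Agree P c x y = ∀ i → P i ≡ c → lookup x i ≡ lookup y i

module _ {n} {P : Partition n} {c : Bool} where

  write-Agree : ∀ {l} (ps : Fin l → Fin n) s {x y} → Agree P c x y → Agree P c (write ps s x) (write ps s y)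
  write-Agree ps []      x≈y = x≈y
  write-Agree ps (a ∷ s) {x} {y} x≈y i Pi with i ≟ᶠ ps zero
  ... | yes refl = trans (lookup∘update i (write (ps ∘ suc) s x) a) (sym (lookup∘update i (write (ps ∘ suc) s y) a))
  ... | no  i≢p  = trans (lookup∘update′ i≢p (write (ps ∘ suc) s x) a)
                    (trans (write-Agree (ps ∘ suc) s x≈y i Pi) (sym (lookup∘update′ i≢p (write (ps ∘ suc) s y) a)))

  write-outside-Agree : ∀ {l} (ps : Fin l → Fin n) → (∀ k → P (ps k) ≢ c) → ∀ s x → Agree P c (write ps s x) x
  write-outside-Agree ps ps∉ s x i Pi = lookup-write-∉ ps s x (λ k e → ps∉ k (trans (cong P e) Pi))

sumOver-update : ∀ n (i : Fin n) (h : Assignment n → ℕ) →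
  sumOver n (λ z → h (z [ i ]≔ false) + h (z [ i ]≔ true)) ≡ 2 * sumOver n h
sumOver-update (suc n) zero h =
  trans (cong₂ _+_ both both) (cong (sumOver (suc n) h +_) (sym (+-identityʳ _)))
  where both = sumOver-+ n (h ∘ (false ∷_)) (h ∘ (true ∷_))
sumOver-update (suc n) (suc i) h =
  trans (cong₂ _+_ (sumOver-update n i (h ∘ (false ∷_))) (sumOver-update n i (h ∘ (true ∷_))))
        (sym (*-distribˡ-+ 2 (sumOver n (h ∘ (false ∷_))) (sumOver n (h ∘ (true ∷_)))))

sumOver-write : ∀ {n} l (ps : Fin l → Fin n) (f : Assignment n → ℕ) →
  sumOver n (λ z → sumOver l (λ s → f (write ps s z))) ≡ 2 ^ l * sumOver n f
sumOver-write {n} zero    ps f = sym (*-identityˡ _)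
sumOver-write {n} (suc l) ps f = begin
  sumOver n (λ z → sumOver (suc l) (λ s → f (write ps s z)))
    ≡⟨ sumOver-cong n (λ z → sym (sumOver-+ l _ _)) ⟩
  sumOver n (λ z → sumOver l (λ s → g (write (ps ∘ suc) s z)))
    ≡⟨ sumOver-write l (ps ∘ suc) g ⟩
  2 ^ l * sumOver n g
    ≡⟨ cong (2 ^ l *_) (sumOver-update n (ps zero) f) ⟩
  2 ^ l * (2 * sumOver n f)
    ≡⟨ sym (*-assoc (2 ^ l) 2 _) ⟩
  2 ^ l * 2 * sumOver n f
    ≡⟨ cong (_* sumOver n f) (*-comm (2 ^ l) 2) ⟩
  2 ^ suc l * sumOver n f ∎
  where
  open ≡-Reasoning
  g : Assignment n → ℕ
  g w = f (w [ ps zero ]≔ false) + f (w [ ps zero ]≔ true)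

-- Parity sums

∑-zero : ∀ {n} (f : Fin n → Bool) → (∀ i → f i ≡ false) → ∑[ i < n ] f i ≡ false
∑-zero {n} f f≡0 = trans (sum-cong-≗ f≡0) (sum-replicate-zero n)

∑-point : ∀ {n} (f : Fin n → Bool) i → (∀ j → j ≢ i → f j ≡ false) → ∑[ j < n ] f j ≡ f i
∑-point f zero    others = trans (cong (f zero xor_) (∑-zero (f ∘ suc) (λ j → others (suc j) λ ())))
                                 (xor-identityʳ (f zero))
∑-point f (suc i) others rewrite others zero (λ ()) =
  ∑-point (f ∘ suc) i (λ j j≢i → others (suc j) (j≢i ∘ suc-injective))

δ : ∀ {n} → Fin n → Fin n → Bool
δ i j = does (i ≟ᶠ j)

∑-δ : ∀ {n} (f : Fin n → Bool) i → ∑[ j < n ] (δ i j ∧ f j) ≡ f i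
∑-δ f i = trans (∑-point _ i (λ j j≢i → cong (_∧ f j) (dec-false (i ≟ᶠ j) (j≢i ∘ sym))))
                (cong (_∧ f i) (dec-true (i ≟ᶠ i) refl))

∑-image : ∀ {m n} {p : Fin m → Fin n} → Injective _≡_ _≡_ p → (f : Fin n → Bool) →
  (∀ i → (∀ a → p a ≢ i) → f i ≡ false) → ∑[ i < n ] f i ≡ ∑[ a < m ] f (p a)
∑-image {m} {n} {p} inj f outside = begin
  ∑[ i < n ] f i                          ≡⟨ sum-cong-≗ spread ⟩
  ∑[ i < n ] ∑[ a < m ] (δ (p a) i ∧ f i) ≡⟨ ∑-comm (λ i a → δ (p a) i ∧ f i) ⟩
  ∑[ a < m ] ∑[ i < n ] (δ (p a) i ∧ f i) ≡⟨ sum-cong-≗ (λ a → ∑-δ f (p a)) ⟩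
  ∑[ a < m ] f (p a)                      ∎
  where
  open ≡-Reasoning
  spread : ∀ i → f i ≡ ∑[ a < m ] (δ (p a) i ∧ f i)
  spread i with any? (λ a → p a ≟ᶠ i)
  ... | yes (a , refl) = sym (trans (∑-point _ a others) (cong (_∧ f (p a)) (dec-true (p a ≟ᶠ p a) refl)))
    where
    others : ∀ a' → a' ≢ a → δ (p a') (p a) ∧ f (p a) ≡ false
    others a' a'≢a = cong (_∧ f (p a)) (dec-false (p a' ≟ᶠ p a) (a'≢a ∘ inj))
  ... | no  i∉p = trans (outside i (λ a e → i∉p (a , e))) (sym (∑-zero _ none))
    where
    none : ∀ a → δ (p a) i ∧ f i ≡ false
    none a = cong (_∧ f i) (dec-false (p a ≟ᶠ i) (λ e → i∉p (a , e)))

ascending : ∀ {n} → Fin n → Fin n → Bool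
ascending i j = does (toℕ i <? toℕ j)

∑∑-distrib : ∀ {n} (f g : Fin n → Fin n → Bool) →
  ∑[ i < n ] ∑[ j < n ] (f i j xor g i j) ≡ (∑[ i < n ] ∑[ j < n ] f i j) xor (∑[ i < n ] ∑[ j < n ] g i j)
∑∑-distrib f g = trans (sum-cong-≗ (λ i → ∑-distrib-+ (f i) (g i))) (∑-distrib-+ (sum ∘ f) (sum ∘ g))

∑-ascending : ∀ {n} (h g : Fin n → Fin n → Bool) →
  (∀ i j → h i j ≡ g i j xor g j i) → (∀ i → g i i ≡ false) →
  ∑[ i < n ] ∑[ j < n ] (ascending i j ∧ h i j) ≡ ∑[ i < n ] ∑[ j < n ] g i j
∑-ascending {n} h g h≡g+gᵀ g-diagonal = begin
  ∑[ i < n ] ∑[ j < n ] (ascending i j ∧ h i j)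
    ≡⟨ sum-cong-≗ (λ i → sum-cong-≗ (λ j → trans (cong (ascending i j ∧_) (h≡g+gᵀ i j))
                                                  (∧-distribˡ-xor (ascending i j) (g i j) (g j i)))) ⟩
  ∑[ i < n ] ∑[ j < n ] ((ascending i j ∧ g i j) xor (ascending i j ∧ g j i))
    ≡⟨ ∑∑-distrib (λ i j → ascending i j ∧ g i j) (λ i j → ascending i j ∧ g j i) ⟩
  (∑[ i < n ] ∑[ j < n ] (ascending i j ∧ g i j)) xor (∑[ i < n ] ∑[ j < n ] (ascending i j ∧ g j i))
    ≡⟨ cong ((∑[ i < n ] ∑[ j < n ] (ascending i j ∧ g i j)) xor_) (∑-comm (λ i j → ascending i j ∧ g j i)) ⟩
  (∑[ i < n ] ∑[ j < n ] (ascending i j ∧ g i j)) xor (∑[ j < n ] ∑[ i < n ] (ascending i j ∧ g j i))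
    ≡⟨ sym (∑∑-distrib (λ i j → ascending i j ∧ g i j) (λ i j → ascending j i ∧ g i j)) ⟩
  ∑[ i < n ] ∑[ j < n ] ((ascending i j ∧ g i j) xor (ascending j i ∧ g i j))
    ≡⟨ sum-cong-≗ (λ i → sum-cong-≗ (one-orientation i)) ⟩
  ∑[ i < n ] ∑[ j < n ] g i j ∎
  where
  open ≡-Reasoning
  one-orientation : ∀ i j → (ascending i j ∧ g i j) xor (ascending j i ∧ g i j) ≡ g i j
  one-orientation i j with <-cmpᶠ i j
  ... | tri< i<j _ j≮i rewrite dec-true (toℕ i <? toℕ j) i<j | dec-false (toℕ j <? toℕ i) j≮i = xor-identityʳ (g i j)
  ... | tri> i≮j _ j<i rewrite dec-false (toℕ i <? toℕ j) i≮j | dec-true (toℕ j <? toℕ i) j<i = refl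
  ... | tri≈ _ refl _  = trans (xor-same (ascending i i ∧ g i i)) (sym (g-diagonal i))

xorList : ∀ {X : Set} → (X → Bool) → List X → Bool
xorList f = foldr (λ x acc → f x xor acc) false

xorList-++ : ∀ {X : Set} (f : X → Bool) xs ys → xorList f (xs ++ ys) ≡ xorList f xs xor xorList f ys
xorList-++ f []       ys = refl
xorList-++ f (x ∷ xs) ys = trans (cong (f x xor_) (xorList-++ f xs ys)) (sym (xor-assoc (f x) _ _))

xorList-concatMap : ∀ {X Y : Set} (f : Y → Bool) (h : X → List Y) xs →
  xorList f (concatMap h xs) ≡ xorList (xorList f ∘ h) xs
xorList-concatMap f h []       = refl
xorList-concatMap f h (x ∷ xs) =
  trans (xorList-++ f (h x) (concatMap h xs)) (cong (xorList f (h x) xor_) (xorList-concatMap f h xs))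

xorList-filter : ∀ {X : Set} {Q : X → Set} (f : X → Bool) (Q? : Decidable Q) xs →
  xorList f (filter Q? xs) ≡ xorList (λ x → does (Q? x) ∧ f x) xs
xorList-filter f Q? []       = refl
xorList-filter f Q? (x ∷ xs) with does (Q? x)
... | true  = cong (f x xor_) (xorList-filter f Q? xs)
... | false = xorList-filter f Q? xs

xorList-tabulate : ∀ {X : Set} {n} (f : X → Bool) (g : Fin n → X) → xorList f (tabulate g) ≡ ∑[ i < n ] f (g i)
xorList-tabulate {n = zero}  f g = refl
xorList-tabulate {n = suc n} f g = cong (f (g zero) xor_) (xorList-tabulate f (g ∘ suc))

IP-∑ : ∀ {n} (G : Graph n) (x : Assignment n) →
  IP G x ≡ ∑[ i < n ] ∑[ j < n ] (ascending i j ∧ (adj G i j ∧ (lookup x i ∧ lookup x j)))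
IP-∑ {n} G x = begin
  xorList term (concatMap row (allFin n))    ≡⟨ xorList-concatMap term row (allFin n) ⟩
  xorList (xorList term ∘ row) (allFin n)    ≡⟨ xorList-tabulate {n = n} (xorList term ∘ row) id ⟩
  ∑[ i < n ] xorList term (row i)            ≡⟨ sum-cong-≗ row-∑ ⟩
  ∑[ i < n ] ∑[ j < n ] (ascending i j ∧ term (i , j)) ∎
  where
  open ≡-Reasoning
  term : Fin n × Fin n → Bool
  term (i , j) = adj G i j ∧ (lookup x i ∧ lookup x j)
  row : Fin n → List (Fin n × Fin n)
  row i = map (i ,_) (filter (λ j → toℕ i <? toℕ j) (allFin n))
  row-∑ : ∀ i → xorList term (row i) ≡ ∑[ j < n ] (ascending i j ∧ term (i , j))
  row-∑ i = begin
    xorList term (row i)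
      ≡⟨ foldr-map (λ pr acc → term pr xor acc) (i ,_) false (filter (λ j → toℕ i <? toℕ j) (allFin n)) ⟩
    xorList (term ∘ (i ,_)) (filter (λ j → toℕ i <? toℕ j) (allFin n))
      ≡⟨ xorList-filter (term ∘ (i ,_)) (λ j → toℕ i <? toℕ j) (allFin n) ⟩
    xorList (λ j → ascending i j ∧ term (i , j)) (allFin n)
      ≡⟨ xorList-tabulate {n = n} (λ j → ascending i j ∧ term (i , j)) id ⟩
    ∑[ j < n ] (ascending i j ∧ term (i , j)) ∎

-- IP_G on the corners of a combinatorial rectangle

⊞ : (Bool → Bool → Bool) → Bool
⊞ h = ((h false false xor h true false) xor h false true) xor h true true

⊞-cong : ∀ {h h' : Bool → Bool → Bool} → (∀ a b → h a b ≡ h' a b) → ⊞ h ≡ ⊞ h'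
⊞-cong h≗h' = cong₂ _xor_ (cong₂ _xor_ (cong₂ _xor_ (h≗h' false false) (h≗h' true false)) (h≗h' false true))
                          (h≗h' true true)

⊞-∧ˡ : ∀ c h → ⊞ (λ a b → c ∧ h a b) ≡ c ∧ ⊞ h
⊞-∧ˡ false h = refl
⊞-∧ˡ true  h = refl

⊞-∑ : ∀ {n} (f : Bool → Bool → Fin n → Bool) → ⊞ (λ a b → ∑[ i < n ] f a b i) ≡ ∑[ i < n ] ⊞ (λ a b → f a b i)
⊞-∑ {n} f = sym (begin
  ∑[ i < n ] (((f false false i xor f true false i) xor f false true i) xor f true true i)
    ≡⟨ ∑-distrib-+ (λ i → (f false false i xor f true false i) xor f false true i) (f true true) ⟩
  ∑[ i < n ] ((f false false i xor f true false i) xor f false true i) xor sum (f true true)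
    ≡⟨ cong (_xor sum (f true true)) (∑-distrib-+ (λ i → f false false i xor f true false i) (f false true)) ⟩
  (∑[ i < n ] (f false false i xor f true false i) xor sum (f false true)) xor sum (f true true)
    ≡⟨ cong (λ x → (x xor sum (f false true)) xor sum (f true true)) (∑-distrib-+ (f false false) (f true false)) ⟩
  ⊞ (λ a b → sum (f a b)) ∎)
  where open ≡-Reasoning

⊞-row-constant : ∀ {h : Bool → Bool → Bool} → (∀ a b → h a b ≡ h a false) → ⊞ h ≡ false
⊞-row-constant {h} rows rewrite rows false true | rows true true = cancel (h false false) (h true false)
  where
  cancel : ∀ x y → ((x xor y) xor x) xor y ≡ false
  cancel false false = refl
  cancel false true  = refl
  cancel true  false = refl
  cancel true  true  = refl

⊞-column-constant : ∀ {h : Bool → Bool → Bool} → (∀ a b → h a b ≡ h false b) → ⊞ h ≡ false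
⊞-column-constant {h} columns rewrite columns true false | columns true true =
  trans (cong (λ x → (x xor h false true) xor h false true) (xor-same (h false false))) (xor-same (h false true))

⊞-rank-one : ∀ (f g : Bool → Bool) → ⊞ (λ a b → f a ∧ g b) ≡ (f false xor f true) ∧ (g false xor g true)
⊞-rank-one f g = sym (begin
  (f₀ xor f₁) ∧ (g₀ xor g₁)                         ≡⟨ ∧-distribˡ-xor (f₀ xor f₁) g₀ g₁ ⟩
  ((f₀ xor f₁) ∧ g₀) xor ((f₀ xor f₁) ∧ g₁)         ≡⟨ cong₂ _xor_ (∧-distribʳ-xor g₀ f₀ f₁) (∧-distribʳ-xor g₁ f₀ f₁) ⟩
  (f₀ ∧ g₀ xor f₁ ∧ g₀) xor (f₀ ∧ g₁ xor f₁ ∧ g₁)   ≡⟨ sym (xor-assoc (f₀ ∧ g₀ xor f₁ ∧ g₀) (f₀ ∧ g₁) (f₁ ∧ g₁)) ⟩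
  ⊞ (λ a b → f a ∧ g b)                             ∎)
  where
  open ≡-Reasoning
  f₀ = f false
  f₁ = f true
  g₀ = g false
  g₁ = g true

record RectangleFamily {n} (P : Partition n) (w : Bool → Bool → Assignment n) : Set where
  field
    X₁-by-row    : ∀ a b → Agree P false (w a b) (w a false)
    X₂-by-column : ∀ a b → Agree P true (w a b) (w false b)

cutForm : ∀ {n} → Graph n → Partition n → (Fin n → Bool) → Bool
cutForm {n} G P d = ∑[ i < n ] ∑[ j < n ] (ascending i j ∧ (adj G i j ∧ ((P i xor P j) ∧ (d i ∧ d j))))

module _ {n} {P : Partition n} {w : Bool → Bool → Assignment n} (fam : RectangleFamily P w) where
  open RectangleFamily fam

  -- On X₁ this is the difference of the two rows, on X₂ that of the two columns.
  diagonal : Fin n → Bool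
  diagonal i = lookup (w false false) i xor lookup (w true true) i

  ⊞-vertex-pair : ∀ i j →
    ⊞ (λ a b → lookup (w a b) i ∧ lookup (w a b) j) ≡ (P i xor P j) ∧ (diagonal i ∧ diagonal j)
  ⊞-vertex-pair i j with P i in Pi | P j in Pj
  ... | false | false = ⊞-row-constant (λ a b → cong₂ _∧_ (X₁-by-row a b i Pi) (X₁-by-row a b j Pj))
  ... | true  | true  = ⊞-column-constant (λ a b → cong₂ _∧_ (X₂-by-column a b i Pi) (X₂-by-column a b j Pj))
  ... | false | true  = begin
    ⊞ (λ a b → lookup (w a b) i ∧ lookup (w a b) j)
      ≡⟨ ⊞-cong (λ a b → cong₂ _∧_ (X₁-by-row a b i Pi) (X₂-by-column a b j Pj)) ⟩
    ⊞ (λ a b → lookup (w a false) i ∧ lookup (w false b) j)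
      ≡⟨ ⊞-rank-one (λ a → lookup (w a false) i) (λ b → lookup (w false b) j) ⟩
    (lookup (w false false) i xor lookup (w true false) i) ∧ (lookup (w false false) j xor lookup (w false true) j)
      ≡⟨ sym (cong₂ (λ x y → (lookup (w false false) i xor x) ∧ (lookup (w false false) j xor y))
                    (X₁-by-row true true i Pi) (X₂-by-column true true j Pj)) ⟩
    diagonal i ∧ diagonal j ∎
    where open ≡-Reasoning
  ... | true  | false = begin
    ⊞ (λ a b → lookup (w a b) i ∧ lookup (w a b) j)
      ≡⟨ ⊞-cong (λ a b → trans (cong₂ _∧_ (X₂-by-column a b i Pi) (X₁-by-row a b j Pj))
                                (∧-comm (lookup (w false b) i) (lookup (w a false) j))) ⟩
    ⊞ (λ a b → lookup (w a false) j ∧ lookup (w false b) i)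
      ≡⟨ ⊞-rank-one (λ a → lookup (w a false) j) (λ b → lookup (w false b) i) ⟩
    (lookup (w false false) j xor lookup (w true false) j) ∧ (lookup (w false false) i xor lookup (w false true) i)
      ≡⟨ sym (cong₂ (λ x y → (lookup (w false false) j xor x) ∧ (lookup (w false false) i xor y))
                    (X₁-by-row true true j Pj) (X₂-by-column true true i Pi)) ⟩
    diagonal j ∧ diagonal i
      ≡⟨ ∧-comm (diagonal j) (diagonal i) ⟩
    diagonal i ∧ diagonal j ∎
    where open ≡-Reasoning

  ⊞-IP : ∀ (G : Graph n) → ⊞ (λ a b → IP G (w a b)) ≡ cutForm G P diagonal
  ⊞-IP G = begin
    ⊞ (λ a b → IP G (w a b))
      ≡⟨ ⊞-cong (λ a b → IP-∑ G (w a b)) ⟩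
    ⊞ (λ a b → ∑[ i < n ] ∑[ j < n ] term a b i j)
      ≡⟨ ⊞-∑ (λ a b i → ∑[ j < n ] term a b i j) ⟩
    ∑[ i < n ] ⊞ (λ a b → ∑[ j < n ] term a b i j)
      ≡⟨ sum-cong-≗ (λ i → trans (⊞-∑ (λ a b → term a b i)) (sum-cong-≗ (pair i))) ⟩
    cutForm G P diagonal ∎
    where
    open ≡-Reasoning
    term : Bool → Bool → Fin n → Fin n → Bool
    term a b i j = ascending i j ∧ (adj G i j ∧ (lookup (w a b) i ∧ lookup (w a b) j))
    pair : ∀ i j → ⊞ (λ a b → term a b i j) ≡ ascending i j ∧ (adj G i j ∧ ((P i xor P j) ∧ (diagonal i ∧ diagonal j)))
    pair i j = trans (⊞-∧ˡ (ascending i j) (λ a b → adj G i j ∧ (lookup (w a b) i ∧ lookup (w a b) j)))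
      (cong (ascending i j ∧_) (trans (⊞-∧ˡ (adj G i j) (λ a b → lookup (w a b) i ∧ lookup (w a b) j))
                                      (cong (adj G i j ∧_) (⊞-vertex-pair i j))))

-- Induced matchings crossing the partition

record CrossingMatching {n} (G : Graph n) (P : Partition n) (m : ℕ) : Set where
  field
    p q         : Fin m → Fin n
    p∈X₁        : ∀ k → P (p k) ≡ false
    q∈X₂        : ∀ k → P (q k) ≡ true
    p-injective : Injective _≡_ _≡_ p
    q-injective : Injective _≡_ _≡_ q
    matched     : ∀ k → adj G (p k) (q k) ≡ true
    induced     : ∀ {k k'} → k ≢ k' → adj G (p k) (q k') ≡ false

  p∉X₂ : ∀ k → P (p k) ≢ true
  p∉X₂ k e with () ← trans (sym (p∈X₁ k)) e

  q∉X₁ : ∀ k → P (q k) ≢ false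
  q∉X₁ k e with () ← trans (sym (q∈X₂ k)) e

module _ {n m} {G : Graph n} {P : Partition n} (C : CrossingMatching G P m) where
  open CrossingMatching C

  -- g orients each crossing edge from X₁ to X₂; since d vanishes off the matching and the matching is
  -- induced, only the matching edges survive.
  cutForm-matching : (d : Fin n → Bool) → (∀ i → (∀ k → p k ≢ i) → (∀ k → q k ≢ i) → d i ≡ false) →
    cutForm G P d ≡ ∑[ k < m ] (d (p k) ∧ d (q k))
  cutForm-matching d unmatched = begin
    cutForm G P d
      ≡⟨ ∑-ascending _ g symmetrise diagonal-zero ⟩
    ∑[ i < n ] ∑[ j < n ] g i j
      ≡⟨ ∑-image p-injective (sum ∘ g) (λ i i∉p → ∑-zero (g i) (from-X₁ i i∉p)) ⟩
    ∑[ k < m ] ∑[ j < n ] g (p k) j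
      ≡⟨ sum-cong-≗ (λ k → ∑-image q-injective (g (p k)) (to-X₂ k)) ⟩
    ∑[ k < m ] ∑[ k' < m ] g (p k) (q k')
      ≡⟨ sum-cong-≗ (λ k → ∑-point _ k (λ k' k'≢k → off-diagonal (k'≢k ∘ sym))) ⟩
    ∑[ k < m ] g (p k) (q k)
      ≡⟨ sum-cong-≗ on-matching ⟩
    ∑[ k < m ] (d (p k) ∧ d (q k)) ∎
    where
    open ≡-Reasoning
    g : Fin n → Fin n → Bool
    g i j = not (P i) ∧ (P j ∧ (adj G i j ∧ (d i ∧ d j)))

    symmetrise : ∀ i j → adj G i j ∧ ((P i xor P j) ∧ (d i ∧ d j)) ≡ g i j xor g j i
    symmetrise i j rewrite symmetric G j i | ∧-comm (d j) (d i) = split (adj G i j) (P i) (P j) (d i ∧ d j)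
      where
      split : ∀ a x y e → a ∧ ((x xor y) ∧ e) ≡ (not x ∧ (y ∧ (a ∧ e))) xor (not y ∧ (x ∧ (a ∧ e)))
      split a false false e = ∧-zeroʳ a
      split a false true  e = sym (xor-identityʳ (a ∧ e))
      split a true  false e = refl
      split a true  true  e = ∧-zeroʳ a

    diagonal-zero : ∀ i → g i i ≡ false
    diagonal-zero i with P i
    ... | false = refl
    ... | true  = refl

    from-X₁ : ∀ i → (∀ k → p k ≢ i) → ∀ j → g i j ≡ false
    from-X₁ i i∉p j with P i in Pi
    ... | true  = refl
    ... | false rewrite unmatched i i∉p (λ k e → q∉X₁ k (trans (cong P e) Pi)) | ∧-zeroʳ (adj G i j) = ∧-zeroʳ (P j)

    to-X₂ : ∀ k j → (∀ k' → q k' ≢ j) → g (p k) j ≡ false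
    to-X₂ k j j∉q rewrite p∈X₁ k with P j in Pj
    ... | false = refl
    ... | true rewrite unmatched j (λ k' e → p∉X₂ k' (trans (cong P e) Pj)) j∉q
                     | ∧-zeroʳ (d (p k)) = ∧-zeroʳ (adj G (p k) j)

    off-diagonal : ∀ {k k'} → k ≢ k' → g (p k) (q k') ≡ false
    off-diagonal {k} {k'} k≢k' rewrite p∈X₁ k | q∈X₂ k' | induced k≢k' = refl

    on-matching : ∀ k → g (p k) (q k) ≡ d (p k) ∧ d (q k)
    on-matching k rewrite p∈X₁ k | q∈X₂ k | matched k = refl

module _ {n m} {G : Graph n} (M : InducedMatching G m) where

  Endpoint : Fin m → Fin n → Set
  Endpoint k x = x ≡ u M k ⊎ x ≡ v M k

  endpoints-injective : ∀ (f : Fin m → Fin n) → (∀ k → Endpoint k (f k)) → Injective _≡_ _≡_ f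
  endpoints-injective f f-end {k} {k'} fk≡fk' with k ≟ᶠ k' | f-end k | f-end k'
  ... | yes k≡k' | _         | _          = k≡k'
  ... | no  k≢k' | inj₁ e    | inj₁ e'    = ⊥-elim (disj-uu M k k' k≢k' (trans (sym e) (trans fk≡fk' e')))
  ... | no  k≢k' | inj₁ e    | inj₂ e'    = ⊥-elim (disj-uv M k k' k≢k' (trans (sym e) (trans fk≡fk' e')))
  ... | no  k≢k' | inj₂ e    | inj₁ e'    = ⊥-elim (disj-uv M k' k (k≢k' ∘ sym) (trans (sym e') (trans (sym fk≡fk') e)))
  ... | no  k≢k' | inj₂ e    | inj₂ e'    = ⊥-elim (disj-vv M k k' k≢k' (trans (sym e) (trans fk≡fk' e')))

  endpoints-nonadjacent : ∀ {k k' x y} → k ≢ k' → Endpoint k x → Endpoint k' y → adj G x y ≡ false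
  endpoints-nonadjacent k≢k' (inj₁ refl) (inj₁ refl) = ind-uu M _ _ k≢k'
  endpoints-nonadjacent k≢k' (inj₁ refl) (inj₂ refl) = ind-uv M _ _ k≢k'
  endpoints-nonadjacent {k} {k'} k≢k' (inj₂ refl) (inj₁ refl) =
    trans (symmetric G (v M k) (u M k')) (ind-uv M k' k (k≢k' ∘ sym))
  endpoints-nonadjacent k≢k' (inj₂ refl) (inj₂ refl) = ind-vv M _ _ k≢k'

  orient : {P : Partition n} → (∀ k → P (u M k) ≢ P (v M k)) → CrossingMatching G P m
  orient {P} crossing = record
    { p = p ; q = q
    ; p∈X₁ = p∈X₁ ; q∈X₂ = q∈X₂
    ; p-injective = endpoints-injective p p-endpoint
    ; q-injective = endpoints-injective q q-endpoint
    ; matched = matched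
    ; induced = λ k≢k' → endpoints-nonadjacent k≢k' (p-endpoint _) (q-endpoint _)
    }
    where
    p q : Fin m → Fin n
    p k = if P (u M k) then v M k else u M k
    q k = if P (u M k) then u M k else v M k

    p-endpoint : ∀ k → Endpoint k (p k)
    p-endpoint k with P (u M k)
    ... | true  = inj₂ refl
    ... | false = inj₁ refl

    q-endpoint : ∀ k → Endpoint k (q k)
    q-endpoint k with P (u M k)
    ... | true  = inj₁ refl
    ... | false = inj₂ refl

    v-opposite : ∀ k → P (v M k) ≡ not (P (u M k))
    v-opposite k = ¬-not (crossing k ∘ sym)

    p∈X₁ : ∀ k → P (p k) ≡ false
    p∈X₁ k with P (u M k) in Pu
    ... | true  = trans (v-opposite k) (cong not Pu)
    ... | false = Pu

    q∈X₂ : ∀ k → P (q k) ≡ true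
    q∈X₂ k with P (u M k) in Pu
    ... | true  = Pu
    ... | false = trans (v-opposite k) (cong not Pu)

    matched : ∀ k → adj G (p k) (q k) ≡ true
    matched k with P (u M k)
    ... | true  = trans (symmetric G (v M k) (u M k)) (isEdge M k)
    ... | false = isEdge M k

-- Slicing a rectangle along the matching

module _ {n m} {G : Graph n} {P : Partition n} (C : CrossingMatching G P m) (R : Rectangle P) where
  open CrossingMatching C

  slice : Assignment n → Assignment m → Assignment m → Assignment n
  slice z s t = write q t (write p s z)

  R₁-section R₂-section : Assignment n → Assignment m → Bool
  R₁-section z s = R₁ R (write p s z)
  R₂-section z t = R₂ R (write q t z)

  slice-X₁ : ∀ z s t → Agree P false (slice z s t) (write p s z)
  slice-X₁ z s t = write-outside-Agree q q∉X₁ t (write p s z)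

  slice-X₂ : ∀ z s t → Agree P true (slice z s t) (write q t z)
  slice-X₂ z s t = write-Agree q t (write-outside-Agree p p∉X₂ s z)

  rect-slice : ∀ z s t → rect R (slice z s t) ≡ R₁-section z s ∧ R₂-section z t
  rect-slice z s t = cong₂ _∧_ (R₁-X₁ R _ _ (slice-X₁ z s t)) (R₂-X₂ R _ _ (slice-X₂ z s t))

  lookup-slice-p : ∀ z s t k → lookup (slice z s t) (p k) ≡ lookup s k
  lookup-slice-p z s t k =
    trans (lookup-write-∉ q t _ (λ k' e → q∉X₁ k' (trans (cong P e) (p∈X₁ k)))) (lookup-write-∈ p-injective s z k)

  lookup-slice-q : ∀ z s t k → lookup (slice z s t) (q k) ≡ lookup t k
  lookup-slice-q z s t k = lookup-write-∈ q-injective t (write p s z) k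

  lookup-slice-unmatched : ∀ z s t i → (∀ k → p k ≢ i) → (∀ k → q k ≢ i) → lookup (slice z s t) i ≡ lookup z i
  lookup-slice-unmatched z s t i i∉p i∉q = trans (lookup-write-∉ q t _ i∉q) (lookup-write-∉ p s z i∉p)

  module _ (z : Assignment n) (s s' t t' : Assignment m) where

    S T : Bool → Assignment m
    S a = if a then s' else s
    T b = if b then t' else t

    corners : Bool → Bool → Assignment n
    corners a b = slice z (S a) (T b)

    corners-family : RectangleFamily P corners
    corners-family = record
      { X₁-by-row    = λ a b i Pi → trans (slice-X₁ z (S a) (T b) i Pi) (sym (slice-X₁ z (S a) (T false) i Pi))
      ; X₂-by-column = λ a b i Pi → trans (slice-X₂ z (S a) (T b) i Pi) (sym (slice-X₂ z (S false) (T b) i Pi))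
      }

    ⊞-IP-corners : ⊞ (λ a b → IP G (corners a b)) ≡ ip (zipWith _xor_ s s') (zipWith _xor_ t t')
    ⊞-IP-corners = begin
      ⊞ (λ a b → IP G (corners a b))
        ≡⟨ ⊞-IP corners-family G ⟩
      cutForm G P (diagonal corners-family)
        ≡⟨ cutForm-matching C (diagonal corners-family) unmatched ⟩
      ∑[ k < m ] (diagonal corners-family (p k) ∧ diagonal corners-family (q k))
        ≡⟨ sum-cong-≗ (λ k → cong₂ _∧_
             (trans (cong₂ _xor_ (lookup-slice-p z s t k) (lookup-slice-p z s' t' k)) (sym (lookup-zipWith _xor_ k s s')))
             (trans (cong₂ _xor_ (lookup-slice-q z s t k) (lookup-slice-q z s' t' k)) (sym (lookup-zipWith _xor_ k t t')))) ⟩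
      ip (zipWith _xor_ s s') (zipWith _xor_ t t') ∎
      where
      open ≡-Reasoning
      unmatched : ∀ i → (∀ k → p k ≢ i) → (∀ k → q k ≢ i) → diagonal corners-family i ≡ false
      unmatched i i∉p i∉q = trans (cong₂ _xor_ (lookup-slice-unmatched z s t i i∉p i∉q)
                                               (lookup-slice-unmatched z s' t' i i∉p i∉q))
                                  (xor-same (lookup z i))

  sections-orthogonal : Monochromatic G R → ∀ z → OrthogonalDifferences (R₁-section z) (R₂-section z)
  sections-orthogonal (c , mono) z s s' t t' As As' Bt Bt' =
    trans (sym (⊞-IP-corners z s s' t t')) (trans (⊞-cong (λ a b → mono _ (corner∈R a b))) (⊞-constant c))
    where
    corner∈R : ∀ a b → rect R (corners z s s' t t' a b) ≡ true
    corner∈R a b = trans (rect-slice z (if a then s' else s) (if b then t' else t)) (cong₂ _∧_ (row a) (column b))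
      where
      row : ∀ a → R₁-section z (if a then s' else s) ≡ true
      row false = As
      row true  = As'
      column : ∀ b → R₂-section z (if b then t' else t) ≡ true
      column false = Bt
      column true  = Bt'
    ⊞-constant : ∀ c → ⊞ (λ _ _ → c) ≡ false
    ⊞-constant false = refl
    ⊞-constant true  = refl

  count-slices : ∀ z → count (R₁-section z) * count (R₂-section z)
                       ≡ sumOver m (λ s → sumOver m (λ t → indicator (rect R (slice z s t))))
  count-slices z = trans (sumOver-product m m (indicator ∘ R₁-section z) (indicator ∘ R₂-section z))
    (sumOver-cong m (λ s → sumOver-cong m (λ t →
      sym (trans (cong indicator (rect-slice z s t)) (indicator-∧ (R₁-section z s) (R₂-section z t))))))

  monochromatic-count : Monochromatic G R → 2 ^ m * (2 ^ m * count (rect R)) ≤ 2 ^ n * 2 ^ m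
  monochromatic-count mono = begin
    2 ^ m * (2 ^ m * count (rect R))
      ≡⟨ cong (2 ^ m *_) (sym (sumOver-write m q (indicator ∘ rect R))) ⟩
    2 ^ m * sumOver n (λ w → sumOver m (λ t → indicator (rect R (write q t w))))
      ≡⟨ sym (sumOver-write m p (λ w → sumOver m (λ t → indicator (rect R (write q t w))))) ⟩
    sumOver n (λ z → sumOver m (λ s → sumOver m (λ t → indicator (rect R (slice z s t)))))
      ≡⟨ sym (sumOver-cong n count-slices) ⟩
    sumOver n (λ z → count (R₁-section z) * count (R₂-section z))
      ≤⟨ sumOver-bounded n (2 ^ m) (λ z → lindsey m (R₁-section z) (R₂-section z) (sections-orthogonal mono z)) ⟩
    2 ^ n * 2 ^ m ∎
    where open ≤-Reasoning

cancel-2^ : ∀ {m n N} → m ≤ n → 2 ^ m * (2 ^ m * N) ≤ 2 ^ n * 2 ^ m → N ≤ 2 ^ (n ∸ m)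
cancel-2^ {m} {n} {N} m≤n bound =
  *-cancelˡ-≤ (2 ^ m) {{m^n≢0 2 m}} (subst (2 ^ m * N ≤_) 2^n≡2^m*2^[n∸m]
    (*-cancelˡ-≤ (2 ^ m) {{m^n≢0 2 m}} (subst (2 ^ m * (2 ^ m * N) ≤_) (*-comm (2 ^ n) (2 ^ m)) bound)))
  where
  2^n≡2^m*2^[n∸m] : 2 ^ n ≡ 2 ^ m * 2 ^ (n ∸ m)
  2^n≡2^m*2^[n∸m] = begin
    2 ^ n                  ≡⟨ cong (2 ^_) (sym (m+[n∸m]≡n m≤n)) ⟩
    2 ^ (m + (n ∸ m))      ≡⟨ ^-distribˡ-+-* 2 m (n ∸ m) ⟩
    2 ^ m * 2 ^ (n ∸ m)    ∎
    where open ≡-Reasoning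

lemma9 : (n m : ℕ) (G : Graph n) (M : InducedMatching G m) (P : Partition n)
    → (∀ i → P (u M i) ≢ P (v M i))
    → (R : Rectangle P) → Monochromatic G R
    → size R ≤ 2 ^ (n ∸ m)
lemma9 n m G M P crossing R mono = begin
  size R          ≡⟨ length-filter-allAssignments n (rect R) ⟩
  count (rect R)  ≤⟨ cancel-2^ (injective⇒≤ p-injective) (monochromatic-count C R mono) ⟩
  2 ^ (n ∸ m)     ∎
  where
  open ≤-Reasoning
  C = orient M crossing
  open CrossingMatching C using (p-injective)
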